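{- Let $\mathbb{P}$ be any one of the fifteen logics $\mathbb{PCL},\mathbb{PN},\mathbb{PT},\mathbb{PW},\mathbb{PC},\mathbb{PU},\mathbb{PNU},\mathbb{PTU},\mathbb{PWU},\mathbb{PCU},\mathbb{PA},\mathbb{PNA},\mathbb{PTA},\mathbb{PWA},\mathbb{PCA}$, with axiom system $\mathcal{P}$ and corresponding class $\mathcal{C}_{\mathbb{P}}$ of neighbourhood models. For every formula $F\in\mathcal{L}$, if $F$ is derivable in the axiom system of $\mathbb{P}$, then $F$ is valid in every model of $\mathcal{C}_{\mathbb{P}}$.
   Context: Formulas of $\mathcal{L}$ are built from propositional atoms $p$ and $\bot$ by $\wedge,\vee,\rightarrow$ and a binary conditional $>$; $\neg A$ abbreviates $A\rightarrow\bot$ and $\top$ abbreviates $\neg\bot$. A neighbourhood model is a triple $\mathcal{M}=\langle W,N,\llbracket\cdot\rrbracket\rangle$ where $W$ is a non-empty set, $N:W\to\mathcal{P}(\mathcal{P}(W))$, and $\llbracket\cdot\rrbracket$ assigns to each atom a subset of $W$, such that every $\alpha\in N(x)$ is non-empty. Forcing: $x\Vdash p$ iff $x\in\llbracket p\rrbracket$; $x\not\Vdash\bot$; Boolean connectives classically; for $\alpha\subseteq W$, $\alpha\Vdash^\exists A$ means some $y\in\alpha$ has $y\Vdash A$, and $\alpha\Vdash^\forall A$ means all $y\in\alpha$ have $y\Vdash A$; $x\Vdash A>B$ iff for every $\alpha\in N(x)$ with $\alpha\Vdash^\exists A$ there is $\beta\in N(x)$ with $\beta\subseteq\alpha$, $\beta\Vdash^\exists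 A$ and $\beta\Vdash^\forall A\rightarrow B$. A formula is valid in a model if forced at every world. Model conditions: normality: $N(x)\neq\emptyset$ for all $x$; total reflexivity: for all $x$ there is $\alpha\in N(x)$ with $x\in\alpha$; weak centering: for all $x$ and all $\alpha\in N(x)$, $x\in\alpha$; centering: for all $x$ and $\alpha\in N(x)$, $x\in\alpha$, and $\{x\}\in N(x)$; uniformity: whenever $\alpha\in N(x)$ and $y\in\alpha$, $\bigcup N(x)=\bigcup N(y)$; absoluteness: whenever $\alpha\in N(x)$ and $y\in\alpha$, $N(x)=N(y)$. Axiom systems: all contain classical propositional tautologies, modus ponens, and the rules (RCEA): from $A\leftrightarrow B$ infer $(A>C)\leftrightarrow(B>C)$; (RCK): from $A\rightarrow B$ infer $(C>A)\rightarrow(C>B)$; and axioms (ID) $A>A$; (R-And) $(A>B)\wedge(A>C)\rightarrow(A>(B\wedge C))$; (CM) $(A>B)\wedge(A>C)\rightarrow((A\wedge B)>C)$; (OR) $(A>C)\wedge(B>C)\rightarrow((A\vee B)>C)$. These form $\mathbb{PCL}$. Further axioms: (N) $\neg(\top>\bot)$; (T) $A\rightarrow\neg(A>\bot)$; (W) $(A>B)\rightarrow(A\rightarrow B)$; (C) $(A\wedge B)\rightarrow(A>B)$; (U$_1$) $(\neg A>\bot)\rightarrow(\neg(\neg A>\bot)>\bot)$; (U$_2$) $\neg(A>\bot)\rightarrow((A>\bot)>\bot)$; (A$_1$) $(A>B)\rightarrow(C>(A>B))$; (A$_2$) $\neg(A>B)\rightarrow(C>\neg(A>B))$. $\mathbb{PN}=\mathbb{PCL}$+(N),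 $\mathbb{PT}=\mathbb{PN}$+(T), $\mathbb{PW}=\mathbb{PT}$+(W), $\mathbb{PC}=\mathbb{PW}$+(C); $\mathbb{PU}=\mathbb{PCL}$+(U$_1$)+(U$_2$), and $\mathbb{PNU},\mathbb{PTU},\mathbb{PWU},\mathbb{PCU}$ add successively (N),(T),(W),(C) to $\mathbb{PU}$; $\mathbb{PA}=\mathbb{PCL}$+(A$_1$)+(A$_2$), and $\mathbb{PNA},\mathbb{PTA},\mathbb{PWA},\mathbb{PCA}$ add successively (N),(T),(W),(C) to $\mathbb{PA}$. The corresponding class of models of a logic consists of the neighbourhood models satisfying, for each axiom group it contains, the associated condition: (N) normality, (T) total reflexivity, (W) weak centering, (C) centering, (U$_1$),(U$_2$) uniformity, (A$_1$),(A$_2$) absoluteness. -}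

module Defs where

open import Data.Nat using (ℕ)
open import Data.Bool using (Bool; true; false; T; _∧_; _∨_; not)
open import Data.Empty using () renaming (⊥ to Empty)
open import Data.Product using (Σ; ∃; _×_; _,_)
open import Data.Sum using (_⊎_)
open import Relation.Binary.PropositionalEquality using (_≡_)

infixr 30 _∧'_
infixr 25 _∨'_
infixr 20 _⇒_
infix  35 _>_

data Fm : Set where
  atom : ℕ → Fm
  ⊥'   : Fm
  _∧'_ : Fm → Fm → Fm
  _∨'_ : Fm → Fm → Fm
  _⇒_  : Fm → Fm → Fm
  _>_  : Fm → Fm → Fm

¬' : Fm → Fm
¬' A = A ⇒ ⊥'

⊤' : Fm
⊤' = ¬' ⊥'

_⇔_ : Fm → Fm → Fm
A ⇔ B = (A ⇒ B) ∧' (B ⇒ A)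

-- Classical propositional tautologies (of the full language):
-- atoms and conditional formulas A > B are treated as propositional
-- variables; F is a tautology iff it is true under every Boolean
-- assignment to these.

evalB : (Fm → Bool) → Fm → Bool
evalB v (atom p) = v (atom p)
evalB v ⊥'       = false
evalB v (A ∧' B) = evalB v A ∧ evalB v B
evalB v (A ∨' B) = evalB v A ∨ evalB v B
evalB v (A ⇒ B)  = not (evalB v A) ∨ evalB v B
evalB v (A > B)  = v (A > B)

Tautology : Fm → Set
Tautology F = (v : Fm → Bool) → evalB v F ≡ true

-- The fifteen logics: an extension family (none / U / A) and a level
-- (CL, N, T, W, C), where each level includes the axioms of the previous.

data Family : Set where
  plain famU famA : Family

data Level : Set where
  lCL lN lT lW lC : Level

record Logic : Set where
  constructor logic
  field
    family : Family
    level  : Level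
open Logic public

hasN hasT hasW hasC : Level → Bool
hasN lCL = false
hasN _   = true
hasT lCL = false
hasT lN  = false
hasT _   = true
hasW lW  = true
hasW lC  = true
hasW _   = false
hasC lC  = true
hasC _   = false

data _⊢_ (L : Logic) : Fm → Set where
  taut : ∀ {F} → Tautology F → L ⊢ F
  mp   : ∀ {A B} → L ⊢ (A ⇒ B) → L ⊢ A → L ⊢ B
  rcea : ∀ {A B C} → L ⊢ (A ⇔ B) → L ⊢ ((A > C) ⇔ (B > C))
  rck  : ∀ {A B C} → L ⊢ (A ⇒ B) → L ⊢ ((C > A) ⇒ (C > B))
  ax-id  : ∀ {A} → L ⊢ (A > A)
  ax-and : ∀ {A B C} → L ⊢ (((A > B) ∧' (A > C)) ⇒ (A > (B ∧' C)))
  ax-cm  : ∀ {A B C} → L ⊢ (((A > B) ∧' (A > C)) ⇒ ((A ∧' B) > C))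
  ax-or  : ∀ {A B C} → L ⊢ (((A > C) ∧' (B > C)) ⇒ ((A ∨' B) > C))
  ax-N   : T (hasN (level L)) → L ⊢ ¬' (⊤' > ⊥')
  ax-T   : ∀ {A} → T (hasT (level L)) → L ⊢ (A ⇒ ¬' (A > ⊥'))
  ax-W   : ∀ {A B} → T (hasW (level L)) → L ⊢ ((A > B) ⇒ (A ⇒ B))
  ax-C   : ∀ {A B} → T (hasC (level L)) → L ⊢ ((A ∧' B) ⇒ (A > B))
  ax-U1  : ∀ {A} → family L ≡ famU →
           L ⊢ ((¬' A > ⊥') ⇒ (¬' (¬' A > ⊥') > ⊥'))
  ax-U2  : ∀ {A} → family L ≡ famU →
           L ⊢ (¬' (A > ⊥') ⇒ ((A > ⊥') > ⊥'))
  ax-A1  : ∀ {A B C} → family L ≡ famA →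
           L ⊢ ((A > B) ⇒ (C > (A > B)))
  ax-A2  : ∀ {A B C} → family L ≡ famA →
           L ⊢ (¬' (A > B) ⇒ (C > ¬' (A > B)))

-- To stay in
-- Set (no quantification over all subsets), the neighbourhood set N(x)
-- is presented as an indexed family: N(x) = { nb x i | i : I x }.

_⊆_ : {W : Set} → (W → Set) → (W → Set) → Set
α ⊆ β = ∀ y → α y → β y

_≐_ : {W : Set} → (W → Set) → (W → Set) → Set
α ≐ β = (α ⊆ β) × (β ⊆ α)

record Model : Set₁ where
  field
    W         : Set
    inhabited : W
    I         : W → Set
    nb        : (x : W) → I x → W → Set
    val       : ℕ → W → Set
    nonempty  : ∀ x (i : I x) → ∃ λ y → nb x i y

module _ (M : Model) where
  open Model M

  infix 5 _⊩_
  _⊩_ : W → Fm → Set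
  x ⊩ atom p = val p x
  x ⊩ ⊥'     = Empty
  x ⊩ A ∧' B = (x ⊩ A) × (x ⊩ B)
  x ⊩ A ∨' B = (x ⊩ A) ⊎ (x ⊩ B)
  x ⊩ A ⇒ B  = x ⊩ A → x ⊩ B
  x ⊩ A > B  =
    (i : I x) → (∃ λ y → nb x i y × (y ⊩ A)) →
    Σ (I x) λ j → (nb x j ⊆ nb x i) × (∃ λ y → nb x j y × (y ⊩ A))
                  × (∀ y → nb x j y → y ⊩ A → y ⊩ B)

  Valid : Fm → Set
  Valid F = ∀ x → x ⊩ F

  ⋃N : W → W → Set
  ⋃N x z = Σ (I x) λ i → nb x i z

  Normal TotallyReflexive WeaklyCentered Centered Uniform Absolute : Set
  Normal = ∀ x → I x
  TotallyReflexive = ∀ x → Σ (I x) λ i → nb x i x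
  WeaklyCentered = ∀ x (i : I x) → nb x i x
  Centered = WeaklyCentered × (∀ x → Σ (I x) λ i → nb x i ≐ (λ y → y ≡ x))
  Uniform = ∀ x (i : I x) y → nb x i y → ⋃N x ≐ ⋃N y
  Absolute = ∀ x (i : I x) y → nb x i y →
             (∀ (k : I x) → Σ (I y) λ l → nb x k ≐ nb y l)
           × (∀ (l : I y) → Σ (I x) λ k → nb x k ≐ nb y l)

record InClass (L : Logic) (M : Model) : Set where
  field
    normal   : T (hasN (level L)) → Normal M
    totrefl  : T (hasT (level L)) → TotallyReflexive M
    wcenter  : T (hasW (level L)) → WeaklyCentered M
    center   : T (hasC (level L)) → Centered M
    uniform  : family L ≡ famU → Uniform M
    absolute : family L ≡ famA → Absolute M

-- Under excluded middle, the Boolean valuation recording which formulas hold at a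
-- world x reflects forcing at x, so tautologies are forced everywhere. Each
-- conditional axiom is validated by an explicit refining neighbourhood. (U₁), (U₂)
-- hold because x ⊩ A > ⊥ depends only on ⋃N(x), and (A₁), (A₂) because x ⊩ A > B
-- depends only on N(x).
module Submission where

open import Defs
open import Level using (0ℓ)
open import Axiom.ExcludedMiddle using (ExcludedMiddle)
open import Data.Bool using (Bool; T)
open import Data.Unit using (tt)
open import Data.Empty using (⊥-elim)
open import Data.Product using (Σ; ∃; _×_; _,_; proj₁; proj₂)
open import Data.Sum using (inj₁; inj₂; [_,_]′) renaming (swap to ⊎-swap)
open import Function using (id; _∘_)
open import Relation.Nullary using (does; proof; yes; no)
open import Relation.Nullary.Reflects
  using (Reflects; ofⁿ; invert; _×-reflects_; _⊎-reflects_; _→-reflects_)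
open import Relation.Binary.PropositionalEquality using (refl; subst; sym)

⊆-trans : {W : Set} {α β γ : W → Set} → α ⊆ β → β ⊆ γ → α ⊆ γ
⊆-trans α⊆β β⊆γ y = β⊆γ y ∘ α⊆β y

≐-sym : {W : Set} {α β : W → Set} → α ≐ β → β ≐ α
≐-sym (α⊆β , β⊆α) = β⊆α , α⊆β

hasW⇒hasT : ∀ l → T (hasW l) → T (hasT l)
hasW⇒hasT lW _ = tt
hasW⇒hasT lC _ = tt

module ModelFacts (M : Model) where
  open Model M

  _⊨_ : W → Fm → Set
  x ⊨ A = _⊩_ M x A

  infix 5 _⊨_ _⊩∃_ _⊩∀_

  _⊩∃_ : (W → Set) → Fm → Set
  α ⊩∃ A = ∃ λ y → α y × y ⊨ A

  _⊩∀_ : (W → Set) → Fm → Set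
  α ⊩∀ A = ∀ y → α y → y ⊨ A

  -- x ⊨ A > B unfolds to  ∀ i → nb x i ⊩∃ A → Refinement x i A B.
  Refinement : (x : W) → I x → Fm → Fm → Set
  Refinement x i A B =
    Σ (I x) λ j → (nb x j ⊆ nb x i) × (nb x j ⊩∃ A) × (nb x j ⊩∀ (A ⇒ B))

  self-refinement : ∀ {A B x i} → nb x i ⊩∃ A → nb x i ⊩∀ (A ⇒ B) → Refinement x i A B
  self-refinement {i = i} meetsA allAB = i , (λ _ → id) , meetsA , allAB

  ⊩∃-map : ∀ {A B α} → (∀ y → y ⊨ A → y ⊨ B) → α ⊩∃ A → α ⊩∃ B
  ⊩∃-map f (y , yα , yA) = y , yα , f y yA

  >-congˡ : ∀ {A B C x} → (∀ y → y ⊨ A → y ⊨ B) → (∀ y → y ⊨ B → y ⊨ A) →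
            x ⊨ A > C → x ⊨ B > C
  >-congˡ {A} {B} A⇒B B⇒A A>C i meetsB with A>C i (⊩∃-map {B} {A} B⇒A meetsB)
  ... | j , j⊆i , meetsA , allAC =
    j , j⊆i , ⊩∃-map {A} {B} A⇒B meetsA , λ y yj yB → allAC y yj (B⇒A y yB)

  >-monoʳ : ∀ {A B C x} → (∀ y → y ⊨ A → y ⊨ B) → x ⊨ C > A → x ⊨ C > B
  >-monoʳ A⇒B C>A i meetsC with C>A i meetsC
  ... | j , j⊆i , meetsC′ , allCA = j , j⊆i , meetsC′ , λ y yj yC → A⇒B y (allCA y yj yC)

  >-id : ∀ {A x} → x ⊨ A > A
  >-id {A} i meetsA = self-refinement {A} {A} meetsA (λ _ _ → id)

  >-and : ∀ {A B C x} → x ⊨ A > B → x ⊨ A > C → x ⊨ A > (B ∧' C)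
  >-and A>B A>C i meetsA with A>B i meetsA
  ... | j , j⊆i , meetsAʲ , allAB with A>C j meetsAʲ
  ... | k , k⊆j , meetsAᵏ , allAC =
    k , ⊆-trans k⊆j j⊆i , meetsAᵏ , λ y yk yA → allAB y (k⊆j y yk) yA , allAC y yk yA

  >-cm : ∀ {A B C x} → x ⊨ A > B → x ⊨ A > C → x ⊨ (A ∧' B) > C
  >-cm A>B A>C i (y , yi , yA , _) with A>B i (y , yi , yA)
  ... | j , j⊆i , meetsAʲ , allAB with A>C j meetsAʲ
  ... | k , k⊆j , (z , zk , zA) , allAC =
    k , ⊆-trans k⊆j j⊆i , (z , zk , zA , allAB z (k⊆j z zk) zA) ,
    λ u uk → allAC u uk ∘ proj₁

  >⊥-elim : ∀ {A x} → x ⊨ A > ⊥' → ⋃N M x ⊩∀ ¬' A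
  >⊥-elim A>⊥ y (i , yi) yA with A>⊥ i (y , yi , yA)
  ... | _ , _ , (z , zj , zA) , allA⊥ = allA⊥ z zj zA

  >⊥-intro : ∀ {A x} → ⋃N M x ⊩∀ ¬' A → x ⊨ A > ⊥'
  >⊥-intro noA i (y , yi , yA) = ⊥-elim (noA y (i , yi) yA)

  >⊥-antitone : ∀ {A x y} → ⋃N M y ⊆ ⋃N M x → x ⊨ A > ⊥' → y ⊨ A > ⊥'
  >⊥-antitone {A} y⊆x A>⊥ = >⊥-intro {A} λ z z∈y → >⊥-elim {A} A>⊥ z (y⊆x z z∈y)

  _≈N_ : W → W → Set
  x ≈N z = (∀ (k : I x) → Σ (I z) λ l → nb x k ≐ nb z l)
         × (∀ (l : I z) → Σ (I x) λ k → nb x k ≐ nb z l)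

  ≈N-sym : ∀ {x z} → x ≈N z → z ≈N x
  ≈N-sym (x→z , z→x) = (λ l → let k , eq = z→x l in k , ≐-sym eq)
                     , (λ k → let l , eq = x→z k in l , ≐-sym eq)

  >-transport : ∀ {A B x z} → x ≈N z → x ⊨ A > B → z ⊨ A > B
  >-transport (x→z , z→x) A>B l (y , yl , yA) with z→x l
  ... | k , (k⊆l , l⊆k) with A>B k (y , l⊆k y yl , yA)
  ... | j , j⊆k , (w , wj , wA) , allAB with x→z j
  ... | l′ , (j⊆l′ , l′⊆j) =
    l′ , ⊆-trans l′⊆j (⊆-trans j⊆k k⊆l) , (w , j⊆l′ w wj , wA) ,
    λ u ul′ → allAB u (l′⊆j u ul′)

  module Classical (lem : ExcludedMiddle 0ℓ) where

    truthValuation : W → Fm → Bool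
    truthValuation x G = does (lem {x ⊨ G})

    reflects-evalB : ∀ x G → Reflects (x ⊨ G) (evalB (truthValuation x) G)
    reflects-evalB x (atom p) = proof lem
    reflects-evalB x ⊥'       = ofⁿ id
    reflects-evalB x (A ∧' B) = reflects-evalB x A ×-reflects reflects-evalB x B
    reflects-evalB x (A ∨' B) = reflects-evalB x A ⊎-reflects reflects-evalB x B
    reflects-evalB x (A ⇒ B)  = reflects-evalB x A →-reflects reflects-evalB x B
    reflects-evalB x (A > B)  = proof lem

    tautology-forced : ∀ {F} → Tautology F → ∀ x → x ⊨ F
    tautology-forced {F} tautF x =
      invert (subst (Reflects (x ⊨ F)) (tautF (truthValuation x)) (reflects-evalB x F))

    -- Refine i for A first; if the result still meets B, refine it once more for B.
    refine-or : ∀ {A B C x i} → x ⊨ A > C → x ⊨ B > C → nb x i ⊩∃ A →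
                Refinement x i (A ∨' B) C
    refine-or {B = B} {x = x} A>C B>C meetsA with A>C _ meetsA
    ... | j , j⊆i , (w , wj , wA) , allAC with lem {nb x j ⊩∃ B}
    ... | no ¬meetsB =
      j , j⊆i , (w , wj , inj₁ wA) ,
      λ y yj → [ allAC y yj , (λ yB → ⊥-elim (¬meetsB (y , yj , yB))) ]′
    ... | yes meetsB with B>C j meetsB
    ... | k , k⊆j , (z , zk , zB) , allBC =
      k , ⊆-trans k⊆j j⊆i , (z , zk , inj₂ zB) ,
      λ y yk → [ allAC y (k⊆j y yk) , allBC y yk ]′

    >-or : ∀ {A B C x} → x ⊨ A > C → x ⊨ B > C → x ⊨ (A ∨' B) > C
    >-or {A} {B} {C} {x} A>C B>C i (y , yi , yAB) with lem {nb x i ⊩∃ A} | yAB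
    ... | yes meetsA | _      = refine-or {A} {B} {C} A>C B>C meetsA
    ... | no ¬meetsA | inj₁ yA = ⊥-elim (¬meetsA (y , yi , yA))
    ... | no _       | inj₂ yB with refine-or {B} {A} {C} B>C A>C (y , yi , yB)
    ... | j , j⊆i , meetsBA , allBAC =
      j , j⊆i , ⊩∃-map {B ∨' A} {A ∨' B} (λ _ → ⊎-swap) meetsBA ,
      λ u uj → allBAC u uj ∘ ⊎-swap

module Soundness (lem : ExcludedMiddle 0ℓ) (M : Model) (L : Logic) (c : InClass L M) where
  open Model M
  open ModelFacts M
  open Classical lem
  open InClass c

  sound : ∀ {F} → L ⊢ F → ∀ x → x ⊨ F
  sound (taut {F} t) = tautology-forced {F} t
  sound (mp A⇒B A) x = sound A⇒B x (sound A x)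
  sound (rcea {A} {B} {C} A⇔B) x =
    >-congˡ {A} {B} {C} (proj₁ ∘ ⊢A⇔B) (proj₂ ∘ ⊢A⇔B) ,
    >-congˡ {B} {A} {C} (proj₂ ∘ ⊢A⇔B) (proj₁ ∘ ⊢A⇔B)
    where ⊢A⇔B = sound A⇔B
  sound (rck {A} {B} {C} A⇒B) x = >-monoʳ {A} {B} {C} (sound A⇒B)
  sound (ax-id {A}) x = >-id {A}
  sound (ax-and {A} {B} {C}) x (A>B , A>C) = >-and {A} {B} {C} A>B A>C
  sound (ax-cm {A} {B} {C}) x (A>B , A>C) = >-cm {A} {B} {C} A>B A>C
  sound (ax-or {A} {B} {C}) x (A>C , B>C) = >-or {A} {B} {C} A>C B>C
  sound (ax-N p) x ⊤>⊥ =
    let i = normal p x ; y , yi = nonempty x i in >⊥-elim {⊤'} ⊤>⊥ y (i , yi) id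
  sound (ax-T {A} p) x xA A>⊥ =
    let i , xi = totrefl p x in >⊥-elim {A} A>⊥ x (i , xi) xA
  sound (ax-W p) x A>B xA with totrefl (hasW⇒hasT (level L) p) x
  ... | i , xi with A>B i (x , xi , xA)
  ... | j , _ , _ , allAB = allAB x (wcenter p x j) xA
  -- {x} ∈ N(x) is the refinement; it lies inside every α ∈ N(x) by weak centering.
  sound (ax-C {B = B} p) x (xA , xB) i _ with center p
  ... | weaklyCentered , singleton with singleton x
  ... | k , (k⊆x , x⊆k) =
    k , (λ u uk → subst (nb x i) (sym (k⊆x u uk)) (weaklyCentered x i)) ,
    (x , x⊆k x refl , xA) , λ u uk _ → subst (_⊨ B) (sym (k⊆x u uk)) xB
  sound (ax-U1 {A} e) x ¬A>⊥ = >⊥-intro {¬' (¬' A > ⊥')} λ y (i , yi) ¬¬A>⊥ →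
    ¬¬A>⊥ (>⊥-antitone {¬' A} (proj₂ (uniform e x i y yi)) ¬A>⊥)
  sound (ax-U2 {A} e) x ¬A>⊥ = >⊥-intro {A > ⊥'} λ y (i , yi) A>⊥ →
    ¬A>⊥ (>⊥-antitone {A} (proj₁ (uniform e x i y yi)) A>⊥)
  sound (ax-A1 {A} {B} {C} e) x A>B i meetsC =
    self-refinement {C} {A > B} meetsC λ z zi _ →
      >-transport {A} {B} (absolute e x i z zi) A>B
  sound (ax-A2 {A} {B} {C} e) x ¬A>B i meetsC =
    self-refinement {C} {¬' (A > B)} meetsC λ z zi _ A>B →
      ¬A>B (>-transport {A} {B} (≈N-sym (absolute e x i z zi)) A>B)

mainTheorem1 : ExcludedMiddle 0ℓ →
    (L : Logic) (F : Fm) → L ⊢ F →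
    (M : Model) → InClass L M → Valid M F
mainTheorem1 lem L F ⊢F M inClass = Soundness.sound lem M L inClass ⊢F
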